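{- Let $G = K_1$ and let $H$ be a connected graph of order $m \ge 1$. Then $\mu(G \odot H) = m+1$ if $H$ is complete, and $\mu(G\odot H) = m$ if $H$ is not complete.
   Context: All graphs are finite, simple, undirected and connected. For a graph $G$ and $X \subseteq V(G)$, two vertices $u,v$ are $X$-visible if there exists a shortest $(u,v)$-path $P$ in $G$ with $V(P)\cap X \subseteq \{u,v\}$. A set $X\subseteq V(G)$ is a mutual-visibility set of $G$ if every two vertices of $X$ are $X$-visible; $\mu(G)$ denotes the maximum cardinality of a mutual-visibility set of $G$. The corona $G\odot H$ is obtained from one copy of $G$ and $|V(G)|$ copies of $H$, the copy associated with $v\in V(G)$ being denoted $H_v$, by joining each $v \in V(G)$ to every vertex of $H_v$ (so $K_1\odot H$ is $H$ with one new vertex adjacent to all vertices of $H$). -}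

module Defs where

open import Data.Nat using (ℕ; zero; suc; _≤_)
open import Data.Fin using (Fin; zero; suc)
open import Data.Fin.Subset using (Subset; _∈_; ∣_∣)
open import Data.Bool using (Bool; true; false; T)
open import Data.List using (List; []; _∷_)
import Data.List.Membership.Propositional as LM
open import Data.Product using (Σ; ∃; _×_)
open import Data.Sum using (_⊎_)
open import Relation.Binary.PropositionalEquality using (_≡_; _≢_)

record Graph (n : ℕ) : Set where
  field
    adj    : Fin n → Fin n → Bool
    sym    : ∀ i j → adj i j ≡ adj j i
    irrefl : ∀ i → adj i i ≡ false

open Graph public

Adj : ∀ {n} → Graph n → Fin n → Fin n → Set
Adj G i j = T (adj G i j)

data Walk {n : ℕ} (G : Graph n) : Fin n → Fin n → Set where
  [_]  : (u : Fin n) → Walk G u u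
  _∷⟨_⟩_ : (u : Fin n) {w v : Fin n} → Adj G u w → Walk G w v → Walk G u v

walkLength : ∀ {n} {G : Graph n} {u v} → Walk G u v → ℕ
walkLength [ u ] = zero
walkLength (u ∷⟨ _ ⟩ p) = suc (walkLength p)

vertices : ∀ {n} {G : Graph n} {u v} → Walk G u v → List (Fin n)
vertices [ u ] = u ∷ []
vertices (u ∷⟨ _ ⟩ p) = u ∷ vertices p

-- A shortest (u,v)-path: a (u,v)-walk of minimum length (such a walk is
-- necessarily a path).
IsShortest : ∀ {n} {G : Graph n} {u v} → Walk G u v → Set
IsShortest {G = G} {u} {v} p = (q : Walk G u v) → walkLength p ≤ walkLength q

Connected : ∀ {n} → Graph n → Set
Connected {n} G = (u v : Fin n) → Walk G u v

Complete : ∀ {n} → Graph n → Set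
Complete {n} G = (i j : Fin n) → i ≢ j → Adj G i j

Visible : ∀ {n} → Graph n → Subset n → Fin n → Fin n → Set
Visible {n} G X u v =
  Σ (Walk G u v) λ p → IsShortest p ×
    ((x : Fin n) → x LM.∈ vertices p → x ∈ X → (x ≡ u ⊎ x ≡ v))

IsMutualVisibilitySet : ∀ {n} → Graph n → Subset n → Set
IsMutualVisibilitySet {n} G X = (u v : Fin n) → u ∈ X → v ∈ X → Visible G X u v

-- μ(G) ≡ k : k is the maximum cardinality of a mutual-visibility set.
IsMu : ∀ {n} → Graph n → ℕ → Set
IsMu {n} G k =
  (∃ λ X → IsMutualVisibilitySet G X × ∣ X ∣ ≡ k) ×
  ((X : Subset n) → IsMutualVisibilitySet G X → ∣ X ∣ ≤ k)

-- K₁ ⊙ H : vertex zero is the K₁ vertex, suc i is vertex i of H.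
coronaAdj : ∀ {m} → Graph m → Fin (suc m) → Fin (suc m) → Bool
coronaAdj H zero zero = false
coronaAdj H zero (suc j) = true
coronaAdj H (suc i) zero = true
coronaAdj H (suc i) (suc j) = adj H i j

coronaSym : ∀ {m} (H : Graph m) i j → coronaAdj H i j ≡ coronaAdj H j i
coronaSym H zero zero = _≡_.refl
coronaSym H zero (suc j) = _≡_.refl
coronaSym H (suc i) zero = _≡_.refl
coronaSym H (suc i) (suc j) = sym H i j

coronaIrrefl : ∀ {m} (H : Graph m) i → coronaAdj H i i ≡ false
coronaIrrefl H zero = _≡_.refl
coronaIrrefl H (suc i) = irrefl H i

K1⊙ : ∀ {m} → Graph m → Graph (suc m)
K1⊙ H = record { adj = coronaAdj H ; sym = coronaSym H ; irrefl = coronaIrrefl H }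

{-# OPTIONS --safe #-}
module Submission where

-- The apex of K₁ ⊙ H is adjacent to every vertex of H, so any two
-- non-adjacent vertices of H see each other along a path of length 2
-- through the apex; hence V(H) is a mutual-visibility set of size m.
-- The whole vertex set of a graph is a mutual-visibility set exactly when
-- the graph is complete (a shortest path avoiding all inner vertices is an
-- edge), and K₁ ⊙ H is complete exactly when H is.

open import Defs
open import Data.Nat using (ℕ; suc; _≤_; _<_; z≤n; s≤s)
open import Data.Nat.Properties using (≤∧≢⇒<; ≤-pred)
open import Data.Fin using (zero; suc; _≟_)
open import Data.Fin.Properties using (suc-injective)
open import Data.Fin.Subset using (Subset; _∈_; _∉_; ∣_∣; ⊤; outside)
open import Data.Vec using (_∷_)
open import Data.Fin.Subset.Properties using (∈⊤; ∣⊤∣≡n; ∣p∣≤n; ∣p∣≡n⇒p≡⊤)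
open import Data.Bool using (T)
open import Data.Bool.Properties using (T?)
open import Data.Unit using (tt)
open import Data.Empty using (⊥-elim)
open import Data.Sum using (_⊎_; inj₁; inj₂)
open import Data.List.Relation.Unary.Any using (here; there)
open import Data.Product using (_×_; _,_)
open import Function using (_∘_)
open import Relation.Nullary using (¬_; yes; no)
open import Relation.Binary.PropositionalEquality using (_≡_; _≢_; refl; subst; cong)
import Data.List.Membership.Propositional as List

module _ {n : ℕ} (G : Graph n) where

  Adj-sym : ∀ {u v} → Adj G u v → Adj G v u
  Adj-sym {u} {v} = subst T (sym G u v)

  Adj-irrefl : ∀ {u} → ¬ Adj G u u
  Adj-irrefl {u} = subst T (irrefl G u)

  1≤walkLength : ∀ {u v} → u ≢ v → (p : Walk G u v) → 1 ≤ walkLength p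
  1≤walkLength u≢v [ u ]         = ⊥-elim (u≢v refl)
  1≤walkLength u≢v (u ∷⟨ _ ⟩ p) = s≤s z≤n

  2≤walkLength : ∀ {u v} → u ≢ v → ¬ Adj G u v → (p : Walk G u v) → 2 ≤ walkLength p
  2≤walkLength u≢v _    [ u ]                    = ⊥-elim (u≢v refl)
  2≤walkLength _   ¬uv (u ∷⟨ uv ⟩ [ v ])         = ⊥-elim (¬uv uv)
  2≤walkLength _   _    (u ∷⟨ _ ⟩ (w ∷⟨ _ ⟩ p)) = s≤s (s≤s z≤n)

  head∈vertices : ∀ {u v} (p : Walk G u v) → u List.∈ vertices p
  head∈vertices [ _ ]         = here refl
  head∈vertices (_ ∷⟨ _ ⟩ _) = here refl

  visible-refl : ∀ X u → Visible G X u u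
  visible-refl X u = [ u ] , (λ _ → z≤n) , λ { x (here x≡u) _ → inj₁ x≡u ; x (there ()) _ }

  visible-adjacent : ∀ X {u v} → u ≢ v → Adj G u v → Visible G X u v
  visible-adjacent X {u} {v} u≢v uv = (u ∷⟨ uv ⟩ [ v ]) , 1≤walkLength u≢v ,
    λ { x (here x≡u) _ → inj₁ x≡u
      ; x (there (here x≡v)) _ → inj₂ x≡v
      ; x (there (there ())) _ }

  visible-via : ∀ X {u v w} → u ≢ v → ¬ Adj G u v → Adj G u w → Adj G w v → w ∉ X →
                Visible G X u v
  visible-via X {u} {v} {w} u≢v ¬uv uw wv w∉X = (u ∷⟨ uw ⟩ (w ∷⟨ wv ⟩ [ v ])) , 2≤walkLength u≢v ¬uv ,
    λ { x (here x≡u) _ → inj₁ x≡u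
      ; x (there (here refl)) x∈X → ⊥-elim (w∉X x∈X)
      ; x (there (there (here x≡v))) _ → inj₂ x≡v
      ; x (there (there (there ()))) _ }

  dominated⇒mutualVisibilitySet : ∀ {X w} → w ∉ X → (∀ x → x ∈ X → Adj G w x) →
                                   IsMutualVisibilitySet G X
  dominated⇒mutualVisibilitySet {X} w∉X w⇝X u v u∈X v∈X with u ≟ v | T? (adj G u v)
  ... | yes refl | _      = visible-refl X u
  ... | no u≢v   | yes uv = visible-adjacent X u≢v uv
  ... | no u≢v   | no ¬uv = visible-via X u≢v ¬uv (Adj-sym (w⇝X u u∈X)) (w⇝X v v∈X) w∉X

  complete⇒IsMu : Complete G → IsMu G n
  complete⇒IsMu complete = (⊤ , mutuallyVisible , ∣⊤∣≡n n) , λ X _ → ∣p∣≤n X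
    where
    mutuallyVisible : IsMutualVisibilitySet G ⊤
    mutuallyVisible u v _ _ with u ≟ v
    ... | yes refl = visible-refl ⊤ u
    ... | no u≢v   = visible-adjacent ⊤ u≢v (complete u v u≢v)

  endpoints-only⇒Adj : ∀ {u v} → u ≢ v → (p : Walk G u v) →
                       (∀ x → x List.∈ vertices p → x ≡ u ⊎ x ≡ v) → Adj G u v
  endpoints-only⇒Adj u≢v [ _ ] _ = ⊥-elim (u≢v refl)
  endpoints-only⇒Adj _ (_∷⟨_⟩_ _ {w} uw p) endpoints with endpoints w (there (head∈vertices p))
  ... | inj₁ refl = ⊥-elim (Adj-irrefl uw)
  ... | inj₂ refl = uw

  ⊤-mutualVisibilitySet⇒complete : IsMutualVisibilitySet G ⊤ → Complete G
  ⊤-mutualVisibilitySet⇒complete mutuallyVisible u v u≢v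
    with mutuallyVisible u v ∈⊤ ∈⊤
  ... | p , _ , avoids⊤ = endpoints-only⇒Adj u≢v p (λ x x∈p → avoids⊤ x x∈p ∈⊤)

  ¬complete⇒∣mutualVisibilitySet∣<n : ¬ Complete G → ∀ {X} → IsMutualVisibilitySet G X → ∣ X ∣ < n
  ¬complete⇒∣mutualVisibilitySet∣<n ¬complete {X} mutuallyVisible = ≤∧≢⇒< (∣p∣≤n X) λ ∣X∣≡n →
    ¬complete (⊤-mutualVisibilitySet⇒complete
      (subst (IsMutualVisibilitySet G) (∣p∣≡n⇒p≡⊤ ∣X∣≡n) mutuallyVisible))

module _ {m : ℕ} (H : Graph m) where

  K1⊙-complete : Complete H → Complete (K1⊙ H)
  K1⊙-complete _        zero    zero    0≢0 = ⊥-elim (0≢0 refl)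
  K1⊙-complete _        zero    (suc j) _   = tt
  K1⊙-complete _        (suc i) zero    _   = tt
  K1⊙-complete complete (suc i) (suc j) i≢j = complete i j (i≢j ∘ cong suc)

  K1⊙-complete⁻¹ : Complete (K1⊙ H) → Complete H
  K1⊙-complete⁻¹ complete i j i≢j = complete (suc i) (suc j) (i≢j ∘ suc-injective)

  copyOfH : Subset (suc m)
  copyOfH = outside ∷ ⊤

  apex-dominates-copyOfH : ∀ x → x ∈ copyOfH → Adj (K1⊙ H) zero x
  apex-dominates-copyOfH (suc _) _ = tt

  copyOfH-mutualVisibilitySet : IsMutualVisibilitySet (K1⊙ H) copyOfH
  copyOfH-mutualVisibilitySet =
    dominated⇒mutualVisibilitySet (K1⊙ H) {w = zero} (λ ()) apex-dominates-copyOfH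

mainTheorem10 : (m : ℕ) → 1 ≤ m → (H : Graph m) → Connected H →
    (Complete H → IsMu (K1⊙ H) (suc m)) × (¬ Complete H → IsMu (K1⊙ H) m)
mainTheorem10 m _ H _ = complete⇒IsMu (K1⊙ H) ∘ K1⊙-complete H , λ ¬complete →
  (copyOfH H , copyOfH-mutualVisibilitySet H , ∣⊤∣≡n m) ,
  λ X mutuallyVisible → ≤-pred
    (¬complete⇒∣mutualVisibilitySet∣<n (K1⊙ H) (¬complete ∘ K1⊙-complete⁻¹ H) mutuallyVisible)
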